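{- Let $G=(V,E)$ be a graph and $v\in V$. If every $\gamma_R(G)$-function $f$ satisfies $f(v)=0$, then $\gamma_R(G-v)=\gamma_R(G)$.
   Context: All graphs are finite, simple and undirected. A Roman dominating function on $G=(V,E)$ is a map $f:V\to\{0,1,2\}$ such that every vertex $u$ with $f(u)=0$ has a neighbor $w$ with $f(w)=2$; its weight is $\sum_{u\in V}f(u)$; $\gamma_R(G)$ is the minimum weight, and a $\gamma_R(G)$-function is a Roman dominating function of weight $\gamma_R(G)$. $G-v$ is $G$ with vertex $v$ deleted. -}

module Defs where

open import Data.Nat using (ℕ; zero; suc; _+_; _≤_)
open import Data.Fin using (Fin; zero; suc; punchIn)
open import Data.Bool using (Bool; true; false)
open import Data.Product using (Σ; _×_; ∃-syntax)
open import Relation.Binary.PropositionalEquality using (_≡_)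

record Graph (n : ℕ) : Set where
  field
    adj    : Fin n → Fin n → Bool
    sym    : ∀ u w → adj u w ≡ adj w u
    irrefl : ∀ u → adj u u ≡ false
open Graph public

_-v_ : ∀ {n} → Graph (suc n) → Fin (suc n) → Graph n
adj    (G -v v) u w = adj G (punchIn v u) (punchIn v w)
sym    (G -v v) u w = sym G (punchIn v u) (punchIn v w)
irrefl (G -v v) u   = irrefl G (punchIn v u)

weight : ∀ {n} → (Fin n → ℕ) → ℕ
weight {zero}  f = 0
weight {suc n} f = f zero + weight (λ i → f (suc i))

record IsRDF {n} (G : Graph n) (f : Fin n → ℕ) : Set where
  field
    bounded   : ∀ u → f u ≤ 2
    dominated : ∀ u → f u ≡ 0 → ∃[ w ] (adj G u w ≡ true × f w ≡ 2)

IsGammaRFunction : ∀ {n} → Graph n → (Fin n → ℕ) → Set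
IsGammaRFunction G f = IsRDF G f × (∀ g → IsRDF G g → weight f ≤ weight g)

IsRomanDominationNumber : ∀ {n} → Graph n → ℕ → Set
IsRomanDominationNumber G k =
  (∃[ f ] (IsRDF G f × weight f ≡ k)) × (∀ g → IsRDF G g → k ≤ weight g)

module Submission where

-- Fix a graph G and a vertex v such that every γ_R(G)-function
-- vanishes at v, and let k = γ_R(G).
--   * Upper bound: a γ_R(G)-function f has f v = 0, and since no vertex needs
--     v as its 2-neighbour, f restricted to G - v is a Roman dominating
--     function of G - v of the same weight k.
--   * Lower bound: a Roman dominating function g of G - v extends to one of G
--     by assigning 1 to v; its weight is 1 + weight g.  If weight g < k, this
--     extension has weight ≤ k, hence is a γ_R(G)-function, which takes the
--     value 1 ≠ 0 at v — contradicting the hypothesis.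

open import Defs hiding (sym)
open import Data.Nat using (ℕ; zero; suc; _+_; _≤_; s≤s; z≤n)
open import Data.Nat.Properties using (+-assoc; +-comm; ≤-refl; ≤-trans; _≤?_; ≰⇒>)
open import Data.Fin using (Fin; zero; suc; punchIn; punchOut; _≟_)
open import Data.Fin.Properties using (punchIn-punchOut)
open import Data.Vec.Functional using (insertAt)
open import Data.Vec.Functional.Properties using (insertAt-lookup; insertAt-punchIn)
open import Data.Product using (_,_; ∃-syntax)
open import Data.Sum using (_⊎_; inj₁; inj₂)
open import Relation.Nullary using (yes; no)
open import Relation.Binary.PropositionalEquality
  using (_≡_; refl; sym; trans; cong; cong₂; subst; module ≡-Reasoning)

restrict : ∀ {n} → Fin (suc n) → (Fin (suc n) → ℕ) → Fin n → ℕ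
restrict v f u = f (punchIn v u)

vertex-split : ∀ {n} (v x : Fin (suc n)) → x ≡ v ⊎ ∃[ u ] (punchIn v u ≡ x)
vertex-split v x with v ≟ x
... | yes v≡x = inj₁ (sym v≡x)
... | no  v≢x = inj₂ (punchOut v≢x , punchIn-punchOut v≢x)

weight-cong : ∀ {n} (f g : Fin n → ℕ) → (∀ i → f i ≡ g i) → weight f ≡ weight g
weight-cong {zero}  f g f≗g = refl
weight-cong {suc n} f g f≗g =
  cong₂ _+_ (f≗g zero) (weight-cong (λ i → f (suc i)) (λ i → g (suc i)) (λ i → f≗g (suc i)))

weight-restrict : ∀ {n} (f : Fin (suc n) → ℕ) (v : Fin (suc n)) →
  weight f ≡ f v + weight (restrict v f)
weight-restrict f zero = refl
weight-restrict {suc n} f (suc v) = begin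
  f zero + weight tail        ≡⟨ cong (f zero +_) (weight-restrict tail v) ⟩
  f zero + (f (suc v) + rest) ≡⟨ sym (+-assoc (f zero) (f (suc v)) rest) ⟩
  f zero + f (suc v) + rest   ≡⟨ cong (_+ rest) (+-comm (f zero) (f (suc v))) ⟩
  f (suc v) + f zero + rest   ≡⟨ +-assoc (f (suc v)) (f zero) rest ⟩
  f (suc v) + (f zero + rest) ∎
  where
    open ≡-Reasoning
    tail : Fin (suc n) → ℕ
    tail i = f (suc i)
    rest : ℕ
    rest = weight (restrict v tail)

weight-insertAt : ∀ {n} (g : Fin n → ℕ) (v : Fin (suc n)) (c : ℕ) →
  weight (insertAt g v c) ≡ c + weight g
weight-insertAt g v c = begin
  weight h                        ≡⟨ weight-restrict h v ⟩
  h v + weight (restrict v h)     ≡⟨ cong₂ _+_ (insertAt-lookup g v c)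
                                       (weight-cong (restrict v h) g (insertAt-punchIn g v c)) ⟩
  c + weight g                    ∎
  where
    open ≡-Reasoning
    h : Fin (suc _) → ℕ
    h = insertAt g v c

-- An RDF of G vanishing at v restricts to an RDF of G - v: no vertex other
-- than v can rely on v as its dominating 2-neighbour, since f v = 0.
restrict-RDF : ∀ {n} (G : Graph (suc n)) (v : Fin (suc n)) (f : Fin (suc n) → ℕ) →
  f v ≡ 0 → IsRDF G f → IsRDF (G -v v) (restrict v f)
IsRDF.bounded (restrict-RDF G v f fv≡0 rdf) u = IsRDF.bounded rdf (punchIn v u)
IsRDF.dominated (restrict-RDF G v f fv≡0 rdf) u fu≡0
  with IsRDF.dominated rdf (punchIn v u) fu≡0
... | w , uw , fw≡2 with vertex-split v w
...   | inj₁ refl with () ← trans (sym fw≡2) fv≡0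
...   | inj₂ (w′ , refl) = w′ , uw , fw≡2

-- An RDF of G - v extends to an RDF of G by any value 1 or 2 at v: the new
-- vertex is not labelled 0, and the old vertices keep their 2-neighbours.
insertAt-RDF : ∀ {n} (G : Graph (suc n)) (v : Fin (suc n)) (g : Fin n → ℕ) (c : ℕ) →
  1 ≤ c → c ≤ 2 → IsRDF (G -v v) g → IsRDF G (insertAt g v c)
IsRDF.bounded (insertAt-RDF G v g c 1≤c c≤2 rdf) x with vertex-split v x
... | inj₁ refl = subst (_≤ 2) (sym (insertAt-lookup g v c)) c≤2
... | inj₂ (u , refl) = subst (_≤ 2) (sym (insertAt-punchIn g v c u)) (IsRDF.bounded rdf u)
IsRDF.dominated (insertAt-RDF G v g c 1≤c c≤2 rdf) x fx≡0 with vertex-split v x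
... | inj₁ refl with () ← subst (1 ≤_) (trans (sym (insertAt-lookup g v c)) fx≡0) 1≤c
... | inj₂ (u , refl)
  with IsRDF.dominated rdf u (trans (sym (insertAt-punchIn g v c u)) fx≡0)
...   | w , uw , gw≡2 = punchIn v w , uw , trans (insertAt-punchIn g v c w) gw≡2

bounded-RDF-isGamma : ∀ {n} (G : Graph n) (f : Fin n → ℕ) (k : ℕ) →
  IsRDF G f → weight f ≤ k → (∀ g → IsRDF G g → k ≤ weight g) → IsGammaRFunction G f
bounded-RDF-isGamma G f k rdf wf≤k k≤all = rdf , λ g rdg → ≤-trans wf≤k (k≤all g rdg)

mainTheorem17 : ∀ {n} (G : Graph (suc n)) (v : Fin (suc n)) →
    (∀ f → IsGammaRFunction G f → f v ≡ 0) →
    ∀ k → IsRomanDominationNumber G k → IsRomanDominationNumber (G -v v) k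
mainTheorem17 G v vanishes k ((f , rdf , wf≡k) , k≤all) =
  (restrict v f , restrict-RDF G v f fv≡0 rdf , weight-restricted) , k≤weight
  where
    fv≡0 : f v ≡ 0
    fv≡0 = vanishes f (bounded-RDF-isGamma G f k rdf (subst (_≤ k) (sym wf≡k) ≤-refl) k≤all)
    weight-restricted : weight (restrict v f) ≡ k
    weight-restricted = begin
      weight (restrict v f)         ≡⟨ cong (_+ weight (restrict v f)) (sym fv≡0) ⟩
      f v + weight (restrict v f)   ≡⟨ sym (weight-restrict f v) ⟩
      weight f                      ≡⟨ wf≡k ⟩
      k                             ∎
      where open ≡-Reasoning

    lighter-extension-vanishes : ∀ g → IsRDF (G -v v) g → suc (weight g) ≤ k →
      insertAt g v 1 v ≡ 0
    lighter-extension-vanishes g rdg lighter = vanishes (insertAt g v 1)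
      (bounded-RDF-isGamma G (insertAt g v 1) k (insertAt-RDF G v g 1 (s≤s z≤n) (s≤s z≤n) rdg)
        (subst (_≤ k) (sym (weight-insertAt g v 1)) lighter) k≤all)

    k≤weight : ∀ g → IsRDF (G -v v) g → k ≤ weight g
    k≤weight g rdg with k ≤? weight g
    ... | yes k≤wg = k≤wg
    ... | no  k≰wg
      with () ← trans (sym (insertAt-lookup g v 1)) (lighter-extension-vanishes g rdg (≰⇒> k≰wg))
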